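{- Let $k\geq 1$ be an integer. The non-negative integer solutions $(x,y,z)$ of the Diophantine equation $2^x+(2^k\cdot 5)^y=z^2$ are exactly: $(x,y,z)=(3,0,3)$ (for any $k\geq 1$), and, for each positive integer $n$, $(k,x,y,z)=(2n,\,2n+2,\,1,\,2^n+2^{n+1})$ and $(k,x,y,z)=(2n+2,\,2n-2,\,1,\,2^{n-1}+2^{n+2})$.
   Context: Here $n$ ranges over the positive integers $\mathbb{N}=\{1,2,3,\dots\}$. -}

module Defs where

open import Data.Nat using (ℕ; suc; _+_; _*_; _∸_; _^_; _≤_)
open import Data.Product using (_×_; ∃-syntax)
open import Data.Sum using (_⊎_)
open import Relation.Binary.PropositionalEquality using (_≡_)

IsListedSolution : ℕ → ℕ → ℕ → ℕ → Set
IsListedSolution k x y z =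
  (x ≡ 3 × y ≡ 0 × z ≡ 3)
  ⊎ (∃[ n ] (1 ≤ n × k ≡ 2 * n × x ≡ 2 * n + 2 × y ≡ 1 × z ≡ 2 ^ n + 2 ^ (n + 1)))
  ⊎ (∃[ n ] (1 ≤ n × k ≡ 2 * n + 2 × x ≡ 2 * n ∸ 2 × y ≡ 1 × z ≡ 2 ^ (n ∸ 1) + 2 ^ (n + 2)))

-- Write z = 2^b·o with o odd.  For y = 0 the equation reads (z - 1)(z + 1) = 2^x, and two
-- powers of 2 differing by 2 are 2 and 4.  For y ≥ 1 put K = k·y and factor 2^min(x,K) out
-- of the left side: the odd cofactor is then o² and the exponent is even.  If x < K, with
-- o = 1 + 2m this becomes m(m + 1) = 2^f·5^y; as 5 cannot divide both of two consecutive
-- numbers, one is a power of 5 and the other a power of 2, and the Catalan-type equations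
-- 5^y + 1 = 2^c, 2^c + 1 = 5^y leave only m = 4.  If x = K then 1 + 5^y = 2o², impossible
-- mod 5.  If x > K then 2^E + 5^y = o² with E = x - K; congruences mod 3, 5 and 8 force
-- E = 2 and y odd, and then (o - 2)(o + 2) = 5^y gives o = 3, y = 1.  In all surviving
-- cases y = 1, so K = k.
module Submission where

open import Defs
open import Data.Empty using (⊥-elim)
open import Data.Fin using (toℕ; fromℕ<)
open import Data.Fin.Properties using (all?; toℕ-fromℕ<)
open import Data.Nat
open import Data.Nat.DivMod
open import Data.Nat.Divisibility
open import Data.Nat.Induction using (<-wellFounded)
open import Data.Nat.Primality
open import Data.Nat.Properties
open import Algebra.Properties.CommutativeSemigroup *-commutativeSemigroup
  using (interchange; x∙yz≈y∙xz; xy∙z≈zx∙y)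
open import Data.Nat.Tactic.RingSolver using (solve-∀)
open import Data.Product using (_×_; _,_; proj₁; proj₂; ∃-syntax; ∃₂)
open import Data.Sum using (_⊎_; inj₁; inj₂; [_,_]; map; swap)
open import Function using (_∘_)
open import Induction.WellFounded using (Acc; acc)
open import Relation.Binary.PropositionalEquality hiding ([_])
open import Relation.Nullary using (yes; no; contradiction)
open import Relation.Nullary.Decidable using (True; toWitness; from-yes; ¬?; _×-dec_; _→-dec_)
open import Relation.Unary using (Decidable)

^-*-interchange : ∀ m i j u v → m ^ i * u * (m ^ j * v) ≡ m ^ (i + j) * (u * v)
^-*-interchange m i j u v = begin
  m ^ i * u * (m ^ j * v) ≡⟨ interchange (m ^ i) u (m ^ j) v ⟩
  m ^ i * m ^ j * (u * v) ≡⟨ cong (_* (u * v)) (^-distribˡ-+-* m i j) ⟨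
  m ^ (i + j) * (u * v)   ∎
  where open ≡-Reasoning

^-distribʳ-* : ∀ m n k → (m * n) ^ k ≡ m ^ k * n ^ k
^-distribʳ-* m n zero    = refl
^-distribʳ-* m n (suc k) =
  trans (cong (m * n *_) (^-distribʳ-* m n k)) (interchange m n (m ^ k) (n ^ k))

^-factorˡ : ∀ a m n w → a ^ m + a ^ suc (m + n) * w ≡ a ^ m * (1 + a ^ suc n * w)
^-factorˡ a m n w = begin
  a ^ m + a ^ suc (m + n) * w     ≡⟨ cong (λ k → a ^ m + a ^ k * w) (+-suc m n) ⟨
  a ^ m + a ^ (m + suc n) * w     ≡⟨ cong (λ p → a ^ m + p * w) (^-distribˡ-+-* a m (suc n)) ⟩
  a ^ m + a ^ m * a ^ suc n * w   ≡⟨ factor (a ^ m) (a ^ suc n) w ⟩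
  a ^ m * (1 + a ^ suc n * w)     ∎
  where
  open ≡-Reasoning
  factor : ∀ p q w → p + p * q * w ≡ p * (1 + q * w)
  factor = solve-∀

^-factorʳ : ∀ a m n w → a ^ suc (m + n) + a ^ m * w ≡ a ^ m * (a ^ suc n + w)
^-factorʳ a m n w = begin
  a ^ suc (m + n) + a ^ m * w     ≡⟨ cong (λ k → a ^ k + a ^ m * w) (+-suc m n) ⟨
  a ^ (m + suc n) + a ^ m * w     ≡⟨ cong (_+ a ^ m * w) (^-distribˡ-+-* a m (suc n)) ⟩
  a ^ m * a ^ suc n + a ^ m * w   ≡⟨ *-distribˡ-+ (a ^ m) (a ^ suc n) w ⟨
  a ^ m * (a ^ suc n + w)         ∎
  where open ≡-Reasoning

2^[2n]≡[2^n]² : ∀ n → 2 ^ (2 * n) ≡ 2 ^ n * 2 ^ n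
2^[2n]≡[2^n]² n = trans (cong (λ k → 2 ^ (n + k)) (+-identityʳ n)) (^-distribˡ-+-* 2 n n)

-- Valuations at a prime

module _ {p : ℕ} (p-prime : Prime p) where
  private instance
    p-nonZero : NonZero p
    p-nonZero = prime⇒nonZero p-prime
    p-nonTrivial : NonTrivial p
    p-nonTrivial = prime⇒nonTrivial p-prime

  ∤1 : p ∤ 1
  ∤1 p∣1 = nonTrivial⇒≢1 (∣1⇒≡1 p∣1)

  ∤-* : ∀ {m n} → p ∤ m → p ∤ n → p ∤ m * n
  ∤-* p∤m p∤n p∣mn = [ p∤m , p∤n ] (euclidsLemma _ _ p-prime p∣mn)

  ∤-^ : ∀ {m} n → p ∤ m → p ∤ m ^ n
  ∤-^ zero    p∤m = ∤1
  ∤-^ (suc n) p∤m = ∤-* p∤m (∤-^ n p∤m)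

  ^≢0 : ∀ c → p ^ c ≢ 0
  ^≢0 c = ≢-nonZero⁻¹ (p ^ c) {{m^n≢0 p c}}

  ^*∤≢0 : ∀ {u} a → p ∤ u → p ^ a * u ≢ 0
  ^*∤≢0 {zero}  a p∤u _ = p∤u (p ∣0)
  ^*∤≢0 {suc u} a p∤u   = ≢-nonZero⁻¹ _ {{m*n≢0 (p ^ a) (suc u) {{m^n≢0 p a}}}}

  valuation-unique : ∀ a b {u v} → p ^ a * u ≡ p ^ b * v → p ∤ u → p ∤ v → a ≡ b × u ≡ v
  valuation-unique zero zero {u} {v} eq _ _ =
    refl , trans (sym (*-identityˡ u)) (trans eq (*-identityˡ v))
  valuation-unique zero (suc b) {u} {v} eq p∤u _ =
    contradiction (subst (p ∣_) (trans (sym eq) (*-identityˡ u)) (∣m⇒∣m*n v (m∣m*n (p ^ b)))) p∤u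
  valuation-unique (suc a) zero eq p∤u p∤v
    with () ← valuation-unique zero (suc a) (sym eq) p∤v p∤u
  valuation-unique (suc a) (suc b) {u} {v} eq p∤u p∤v
    with a≡b , u≡v ← valuation-unique a b
           (*-cancelˡ-≡ _ _ p (trans (sym (*-assoc p (p ^ a) u)) (trans eq (*-assoc p (p ^ b) v))))
           p∤u p∤v
    = cong suc a≡b , u≡v

  ^-injective : ∀ {a b} → p ^ a ≡ p ^ b → a ≡ b
  ^-injective {a} {b} eq = proj₁ (valuation-unique a b (cong (_* 1) eq) ∤1 ∤1)

  p-adic-decomposition : ∀ n → n ≢ 0 → ∃₂ λ b o → n ≡ p ^ b * o × p ∤ o
  p-adic-decomposition n n≢0 = go n {{≢-nonZero n≢0}} (<-wellFounded n)
    where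
    go : ∀ n .{{_ : NonZero n}} → Acc _<_ n → ∃₂ λ b o → n ≡ p ^ b * o × p ∤ o
    go n (acc smaller) with p ∣? n
    ... | no p∤n = 0 , n , sym (*-identityˡ n) , p∤n
    ... | yes p∣n@(divides q n≡q*p)
      with b , o , q≡p^b*o , p∤o ← go q {{quotient≢0 p∣n}} (smaller (quotient-< p∣n))
      = suc b , o , trans n≡q*p (trans (cong (_* p) q≡p^b*o) (xy∙z≈zx∙y (p ^ b) o p)) , p∤o

  factors-of-prime-power : ∀ {u v} c → u * v ≡ p ^ c →
                           ∃₂ λ i j → u ≡ p ^ i × v ≡ p ^ j × i + j ≡ c
  factors-of-prime-power {u} {v} c uv≡p^c
    with i , u′ , refl , p∤u′ ← p-adic-decomposition u (λ { refl → ^≢0 c (sym uv≡p^c) })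
       | j , v′ , refl , p∤v′ ← p-adic-decomposition v
                                  (λ { refl → ^≢0 c (trans (sym uv≡p^c) (*-zeroʳ u)) })
    with i+j≡c , u′v′≡1 ← valuation-unique (i + j) c
           (trans (sym (^-*-interchange p i j u′ v′)) (trans uv≡p^c (sym (*-identityʳ (p ^ c)))))
           (∤-* p∤u′ p∤v′) ∤1
    rewrite m*n≡1⇒m≡1 u′ v′ u′v′≡1 | m*n≡1⇒n≡1 u′ v′ u′v′≡1
    = i , j , *-identityʳ (p ^ i) , *-identityʳ (p ^ j) , i+j≡c

  square-decomposition : ∀ {a u} z → p ^ a * u ≡ z * z → p ∤ u →
                         ∃₂ λ b o → a ≡ b + b × u ≡ o * o × z ≡ p ^ b * o × p ∤ o
  square-decomposition {a} {u} z p^a*u≡z² p∤u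
    with b , o , refl , p∤o ← p-adic-decomposition z (λ { refl → ^*∤≢0 a p∤u p^a*u≡z² })
    with a≡b+b , u≡o² ← valuation-unique a (b + b) (trans p^a*u≡z² (^-*-interchange p b b o o))
                                          p∤u (∤-* p∤o p∤o)
    = b , o , a≡b+b , u≡o² , refl , p∤o

-- Parity and congruences

prime[3] : Prime 3
prime[3] = from-yes (prime? 3)

prime[5] : Prime 5
prime[5] = from-yes (prime? 5)

even⊎odd : ∀ n → ∃[ s ] (n ≡ 2 * s ⊎ n ≡ suc (2 * s))
even⊎odd zero = 0 , inj₁ refl
even⊎odd (suc n) with even⊎odd n
... | s , inj₁ refl = s , inj₂ refl
... | s , inj₂ refl = suc s , inj₁ (cong suc (sym (+-suc s (s + 0))))

2∤1+2* : ∀ s → 2 ∤ 1 + 2 * s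
2∤1+2* s (divides q eq) = even≢odd q s (sym (trans eq (*-comm q 2)))

2∤⇒≡1+2* : ∀ {o} → 2 ∤ o → ∃[ s ] o ≡ 1 + 2 * s
2∤⇒≡1+2* {o} 2∤o with even⊎odd o
... | s , inj₁ refl = contradiction (divides s (*-comm 2 s)) 2∤o
... | s , inj₂ refl = s , refl

2∤5^ : ∀ n → 2 ∤ 5 ^ n
2∤5^ n = ∤-^ prime[2] n (2∤1+2* 2)

5∣5^[1+i] : ∀ i → 5 ∣ 5 ^ suc i
5∣5^[1+i] i = m∣m*n (5 ^ i)

∣-consecutive : ∀ {d n} → d ∣ n → d ∣ suc n → d ∣ 1
∣-consecutive {d} {n} d∣n d∣1+n = ∣m+n∣m⇒∣n (subst (d ∣_) (+-comm 1 n) d∣1+n) d∣n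

[r+dq]%d≡r%d : ∀ r d q .{{_ : NonZero d}} → (r + d * q) % d ≡ r % d
[r+dq]%d≡r%d r d q = trans (cong (λ t → (r + t) % d) (*-comm d q)) ([m+kn]%n≡m%n r q d)

r+dq≡s+dq′⇒r%d≡s%d : ∀ d .{{_ : NonZero d}} {r s q q′} → r + d * q ≡ s + d * q′ → r % d ≡ s % d
r+dq≡s+dq′⇒r%d≡s%d d {r} {s} {q} {q′} eq =
  trans (sym ([r+dq]%d≡r%d r d q)) (trans (cong (_% d) eq) ([r+dq]%d≡r%d s d q′))

m≡1+dq⇒m^n≡1+dq′ : ∀ {m d q} n → m ≡ 1 + d * q → ∃[ q′ ] m ^ n ≡ 1 + d * q′
m≡1+dq⇒m^n≡1+dq′ {d = d} zero _ = 0 , cong suc (sym (*-zeroʳ d))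
m≡1+dq⇒m^n≡1+dq′ {d = d} {q} (suc n) refl
  with q′ , eq ← m≡1+dq⇒m^n≡1+dq′ {d = d} {q = q} n refl
  = q + q′ + d * q * q′ , trans (cong ((1 + d * q) *_) eq) (expand d q q′)
  where
  expand : ∀ d a b → (1 + d * a) * (1 + d * b) ≡ 1 + d * (a + b + d * a * b)
  expand = solve-∀

5^n≡1+4* : ∀ n → ∃[ q ] 5 ^ n ≡ 1 + 4 * q
5^n≡1+4* n = m≡1+dq⇒m^n≡1+dq′ {d = 4} {q = 1} n refl

2^[2n]≡1+3* : ∀ n → ∃[ q ] 2 ^ (2 * n) ≡ 1 + 3 * q
2^[2n]≡1+3* n with q , eq ← m≡1+dq⇒m^n≡1+dq′ {d = 3} {q = 1} n refl =
  q , trans (sym (^-*-assoc 2 2 n)) eq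

5^[2n]≡1+3* : ∀ n → ∃[ q ] 5 ^ (2 * n) ≡ 1 + 3 * q
5^[2n]≡1+3* n with q , eq ← m≡1+dq⇒m^n≡1+dq′ {d = 3} {q = 8} n refl =
  q , trans (sym (^-*-assoc 5 2 n)) eq

5^[2n]≡1+8* : ∀ n → ∃[ q ] 5 ^ (2 * n) ≡ 1 + 8 * q
5^[2n]≡1+8* n with q , eq ← m≡1+dq⇒m^n≡1+dq′ {d = 8} {q = 3} n refl =
  q , trans (sym (^-*-assoc 5 2 n)) eq

[1+2s]²≡1+8* : ∀ s → ∃[ q ] (1 + 2 * s) * (1 + 2 * s) ≡ 1 + 8 * q
[1+2s]²≡1+8* s with even⊎odd s
... | t , inj₁ refl = t + 2 * (t * t) , square t
  where
  square : ∀ t → (1 + 2 * (2 * t)) * (1 + 2 * (2 * t)) ≡ 1 + 8 * (t + 2 * (t * t))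
  square = solve-∀
... | t , inj₂ refl = 1 + 3 * t + 2 * (t * t) , square t
  where
  square : ∀ t → (1 + 2 * suc (2 * t)) * (1 + 2 * suc (2 * t)) ≡ 1 + 8 * (1 + 3 * t + 2 * (t * t))
  square = solve-∀

[1+2m]²≡1+4m[1+m] : ∀ m → (1 + 2 * m) * (1 + 2 * m) ≡ 1 + 2 * (2 * (m * suc m))
[1+2m]²≡1+4m[1+m] = solve-∀

-- The implicit argument is discharged by running the decision procedure on all n residues.
∀-residue : ∀ n .{{_ : NonZero n}} {P : ℕ → Set} (P? : Decidable P) →
            {True (all? {n} (P? ∘ toℕ))} → ∀ m → P (m % n)
∀-residue n {P} P? {ok} m = subst P (toℕ-fromℕ< (m%n<n m n)) (toWitness ok (fromℕ< (m%n<n m n)))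

∀-square-residue : ∀ n .{{_ : NonZero n}} {P : ℕ → Set} (P? : Decidable P) →
                   {True (all? {n} (λ r → P? ((toℕ r * toℕ r) % n)))} → ∀ m → P ((m * m) % n)
∀-square-residue n {P} P? {ok} m =
  subst P (sym (%-distribˡ-* m m n)) (∀-residue n (λ r → P? ((r * r) % n)) {ok} m)

square%3≢2 : ∀ o → (o * o) % 3 ≢ 2
square%3≢2 = ∀-square-residue 3 (λ s → ¬? (s ≟ 2))

square%5≢2,3 : ∀ o → (o * o) % 5 ≢ 2 × (o * o) % 5 ≢ 3
square%5≢2,3 = ∀-square-residue 5 (λ s → ¬? (s ≟ 2) ×-dec ¬? (s ≟ 3))

twice-square%5≢1 : ∀ o → (2 * (o * o)) % 5 ≢ 1
twice-square%5≢1 o = subst (_≢ 1) (sym (%-distribˡ-* 2 (o * o) 5))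
                       (∀-square-residue 5 (λ s → ¬? ((2 * s) % 5 ≟ 1)) o)

4^n%5≡1∨4 : ∀ n → (4 ^ n) % 5 ≡ 1 ⊎ (4 ^ n) % 5 ≡ 4
4^n%5≡1∨4 zero    = inj₁ refl
4^n%5≡1∨4 (suc n) = swap (map times4 times4 (4^n%5≡1∨4 n))
  where
  times4 : ∀ {r} → (4 ^ n) % 5 ≡ r → (4 ^ suc n) % 5 ≡ (4 * r) % 5
  times4 eq = trans (%-distribˡ-* 4 (4 ^ n) 5) (cong (λ r → (4 * r) % 5) eq)

square%5≢2^odd : ∀ t o → (o * o) % 5 ≢ (2 ^ (1 + 2 * t)) % 5
square%5≢2^odd t o eq =
  [ (λ 4^t%5≡1 → proj₁ (square%5≢2,3 o) (square%5≡2* 4^t%5≡1))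
  , (λ 4^t%5≡4 → proj₂ (square%5≢2,3 o) (square%5≡2* 4^t%5≡4)) ] (4^n%5≡1∨4 t)
  where
  square%5≡2* : ∀ {r} → (4 ^ t) % 5 ≡ r → (o * o) % 5 ≡ (2 * r) % 5
  square%5≡2* {r} 4^t%5≡r = begin
    (o * o) % 5             ≡⟨ eq ⟩
    (2 * 2 ^ (2 * t)) % 5   ≡⟨ cong (λ a → (2 * a) % 5) (^-*-assoc 2 2 t) ⟨
    (2 * 4 ^ t) % 5         ≡⟨ %-distribˡ-* 2 (4 ^ t) 5 ⟩
    (2 * ((4 ^ t) % 5)) % 5 ≡⟨ cong (λ r → (2 * r) % 5) 4^t%5≡r ⟩
    (2 * r) % 5             ∎
    where open ≡-Reasoning

2^c%8≡4⇒c≡2 : ∀ c → (2 ^ c) % 8 ≡ 4 → c ≡ 2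
2^c%8≡4⇒c≡2 zero                ()
2^c%8≡4⇒c≡2 (suc zero)          ()
2^c%8≡4⇒c≡2 (suc (suc zero))    _  = refl
2^c%8≡4⇒c≡2 (suc (suc (suc c))) eq =
  contradiction (trans (sym eq) (trans (cong (_% 8) (times8 (2 ^ c))) (m*n%n≡0 (2 ^ c) 8))) λ ()
  where
  times8 : ∀ a → 2 * (2 * (2 * a)) ≡ a * 8
  times8 = solve-∀

-- Exponential equations

2+2^i≡2^j⇒i≡1 : ∀ i {j} → 2 + 2 ^ i ≡ 2 ^ j → i ≡ 1
2+2^i≡2^j⇒i≡1 zero {j} eq =
  contradiction (proj₂ (valuation-unique prime[2] 0 j (trans eq (sym (*-identityʳ (2 ^ j))))
                                         (2∤1+2* 1) (2∤1+2* 0)))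
                λ ()
2+2^i≡2^j⇒i≡1 (suc zero) _ = refl
2+2^i≡2^j⇒i≡1 (suc (suc i)) {j} eq =
  contradiction (suc-injective (proj₂ (valuation-unique prime[2] 1 j
                  (trans (factor (2 ^ i)) (trans eq (sym (*-identityʳ (2 ^ j)))))
                  (2∤1+2* (2 ^ i)) (2∤1+2* 0))))
                (^≢0 prime[2] (suc i))
  where
  factor : ∀ a → 2 * (1 + 2 * a) ≡ 2 + 2 * (2 * a)
  factor = solve-∀

w[2+w]≡2^x : ∀ w x → w * (2 + w) ≡ 2 ^ x → w ≡ 2 × x ≡ 3
w[2+w]≡2^x w x eq
  with i , j , refl , 2+w≡2^j , _ ← factors-of-prime-power prime[2] {w} x eq
  with refl ← 2+2^i≡2^j⇒i≡1 i {j} 2+w≡2^j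
  = refl , ^-injective prime[2] (sym eq)

2^x+1≡square : ∀ x z → 2 ^ x + 1 ≡ z * z → x ≡ 3 × z ≡ 3
2^x+1≡square x zero    eq = contradiction (trans (+-comm 1 (2 ^ x)) eq) λ ()
2^x+1≡square x (suc w) eq = proj₂ w≡2×x≡3 , cong suc (proj₁ w≡2×x≡3)
  where
  square-suc : ∀ w → suc w * suc w ≡ w * (2 + w) + 1
  square-suc = solve-∀
  w≡2×x≡3 : w ≡ 2 × x ≡ 3
  w≡2×x≡3 = w[2+w]≡2^x w x (sym (+-cancelʳ-≡ 1 (2 ^ x) (w * (2 + w)) (trans eq (square-suc w))))

5^[1+y]+1≢2^c : ∀ y c → suc (5 ^ suc y) ≢ 2 ^ c
5^[1+y]+1≢2^c y zero          eq = ^≢0 prime[5] (suc y) (suc-injective eq)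
5^[1+y]+1≢2^c y (suc zero)    eq = contradiction (m*n≡1⇒m≡1 5 (5 ^ y) (suc-injective eq)) λ ()
5^[1+y]+1≢2^c y (suc (suc c)) eq with q , 5^[1+y]≡1+4q ← 5^n≡1+4* (suc y) =
  contradiction (r+dq≡s+dq′⇒r%d≡s%d 4 {2} {0} {q} {2 ^ c}
                  (trans (sym (cong suc 5^[1+y]≡1+4q)) (trans eq (sym (*-assoc 2 2 (2 ^ c))))))
                λ ()

2^c+1≡5^[1+2s]⇒c≡2 : ∀ c s → suc (2 ^ c) ≡ 5 ^ (1 + 2 * s) → c ≡ 2
2^c+1≡5^[1+2s]⇒c≡2 c s eq =
  let q , 5^[2s]≡1+8q = 5^[2n]≡1+8* s
      2^c≡4+8*5q = suc-injective (trans eq (trans (cong (5 *_) 5^[2s]≡1+8q) (distrib q)))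
  in 2^c%8≡4⇒c≡2 c (r+dq≡s+dq′⇒r%d≡s%d 8 {2 ^ c} {4} {0} {5 * q}
                      (trans (+-identityʳ (2 ^ c)) 2^c≡4+8*5q))
  where
  distrib : ∀ q → 5 * (1 + 8 * q) ≡ 1 + (4 + 8 * (5 * q))
  distrib = solve-∀

2^c+1≡5^y : ∀ c y → suc (2 ^ c) ≡ 5 ^ y → c ≡ 2 × y ≡ 1
2^c+1≡5^y c y eq with even⊎odd y
... | s , inj₁ refl with q , 5^[2s]≡1+3q ← 5^[2n]≡1+3* s =
  contradiction (divides q (trans (suc-injective (trans eq 5^[2s]≡1+3q)) (*-comm 3 q)))
                (∤-^ prime[3] c (>⇒∤ (n<1+n 2)))
... | s , inj₂ refl with refl ← 2^c+1≡5^[1+2s]⇒c≡2 c s eq =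
  refl , sym (^-injective prime[5] {1} eq)

odd*v≡2^f*5^y : ∀ {u v} f y → u * v ≡ 2 ^ f * 5 ^ y → 2 ∤ u →
                ∃₂ λ i j → u ≡ 5 ^ i × v ≡ 2 ^ f * 5 ^ j × i + j ≡ y
odd*v≡2^f*5^y {u} {v} f y eq 2∤u
  with c , v′ , refl , 2∤v′ ← p-adic-decomposition prime[2] v
         (λ { refl → ^*∤≢0 prime[2] f (2∤5^ y) (trans (sym eq) (*-zeroʳ u)) })
  with refl , uv′≡5^y ← valuation-unique prime[2] c f (trans (sym (x∙yz≈y∙xz u (2 ^ c) v′)) eq)
                           (∤-* prime[2] 2∤u 2∤v′) (2∤5^ y)
  with i , j , refl , refl , i+j≡y ← factors-of-prime-power prime[5] {u} {v′} y uv′≡5^y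
  = i , j , refl , refl , i+j≡y

-- 5 cannot divide both of the adjacent numbers, so one is a power of 5 and the other a power of 2.
odd*adjacent≡2^f*5^[1+y] : ∀ {a b} f y → a * b ≡ 2 ^ f * 5 ^ suc y → 2 ∤ a →
                           suc a ≡ b ⊎ suc b ≡ a → a ≡ 5 × b ≡ 4 × f ≡ 2 × y ≡ 0
odd*adjacent≡2^f*5^[1+y] f y eq 2∤a adjacent with odd*v≡2^f*5^y f (suc y) eq 2∤a
... | suc i , suc j , refl , refl , _ =
  ⊥-elim (∤1 prime[5] ([ (λ 1+a≡b → ∣-consecutive 5∣a (subst (5 ∣_) (sym 1+a≡b) 5∣b))
                       , (λ 1+b≡a → ∣-consecutive 5∣b (subst (5 ∣_) (sym 1+b≡a) 5∣a)) ] adjacent))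
  where
  5∣a : 5 ∣ 5 ^ suc i
  5∣a = 5∣5^[1+i] i
  5∣b : 5 ∣ 2 ^ f * 5 ^ suc j
  5∣b = ∣n⇒∣m*n (2 ^ f) (5∣5^[1+i] j)
odd*adjacent≡2^f*5^[1+y] f y eq 2∤a (inj₁ 2≡b) | zero , _ , refl , refl , refl =
  ⊥-elim (>⇒∤ (s<s (s<s z<s)) (subst (5 ∣_) (sym 2≡b) (∣n⇒∣m*n (2 ^ f) (5∣5^[1+i] y))))
odd*adjacent≡2^f*5^[1+y] f y eq 2∤a (inj₂ 1+b≡1) | zero , _ , refl , refl , refl =
  ⊥-elim (^*∤≢0 prime[2] f (2∤5^ (suc y)) (suc-injective 1+b≡1))
odd*adjacent≡2^f*5^[1+y] f y eq 2∤a (inj₁ 1+a≡b) | suc i , zero , refl , refl , _ =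
  ⊥-elim (5^[1+y]+1≢2^c i f (trans 1+a≡b (*-identityʳ (2 ^ f))))
odd*adjacent≡2^f*5^[1+y] f y eq 2∤a (inj₂ 1+b≡a) | suc i , zero , refl , refl , 1+0≡1+y
  with refl , refl ← 2^c+1≡5^y f (suc i) (trans (cong suc (sym (*-identityʳ (2 ^ f)))) 1+b≡a)
  = refl , refl , refl , sym (suc-injective 1+0≡1+y)

m[1+m]≡2^f*5^[1+y] : ∀ m f y → m * suc m ≡ 2 ^ f * 5 ^ suc y → m ≡ 4 × f ≡ 2 × y ≡ 0
m[1+m]≡2^f*5^[1+y] m f y eq with even⊎odd m
... | s , inj₁ refl
  with _ , m≡4 , f≡2 , y≡0 ← odd*adjacent≡2^f*5^[1+y] f y (trans (*-comm (suc (2 * s)) (2 * s)) eq)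
                                                        (2∤1+2* s) (inj₂ refl)
  = m≡4 , f≡2 , y≡0
... | s , inj₂ refl
  with m≡5 , 1+m≡4 , _ ← odd*adjacent≡2^f*5^[1+y] f y eq (2∤1+2* s) (inj₁ refl)
  = contradiction (trans (cong suc (sym m≡5)) 1+m≡4) λ ()

2^e*5^[1+y]≡2*m[1+m] : ∀ e y m → 2 ^ e * 5 ^ suc y ≡ 2 * (m * suc m) → e ≡ 3 × y ≡ 0 × m ≡ 4
2^e*5^[1+y]≡2*m[1+m] zero y m eq =
  ⊥-elim (2∤5^ (suc y)
           (divides (m * suc m) (trans (sym (*-identityˡ _)) (trans eq (*-comm 2 (m * suc m))))))
2^e*5^[1+y]≡2*m[1+m] (suc e) y m eq
  with m≡4 , refl , y≡0 ← m[1+m]≡2^f*5^[1+y] m e y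
                            (sym (*-cancelˡ-≡ _ _ 2 (trans (sym (*-assoc 2 (2 ^ e) (5 ^ suc y))) eq)))
  = refl , y≡0 , m≡4

1+2^[1+e]*5^[1+y]≡square : ∀ e y {o} → 2 ∤ o → 1 + 2 ^ suc e * 5 ^ suc y ≡ o * o →
                           e ≡ 3 × y ≡ 0 × o ≡ 9
1+2^[1+e]*5^[1+y]≡square e y 2∤o eq
  with m , refl ← 2∤⇒≡1+2* 2∤o
  with refl , y≡0 , refl ← 2^e*5^[1+y]≡2*m[1+m] e y m
         (*-cancelˡ-≡ _ _ 2 (trans (sym (*-assoc 2 (2 ^ e) (5 ^ suc y)))
                                   (suc-injective (trans eq ([1+2m]²≡1+4m[1+m] m)))))
  = refl , y≡0 , refl

1+5^[1+y]≢2*square : ∀ y o → 1 + 5 ^ suc y ≢ 2 * (o * o)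
1+5^[1+y]≢2*square y o eq =
  twice-square%5≢1 o (trans (cong (_% 5) (sym eq)) ([r+dq]%d≡r%d 1 5 (5 ^ y)))

2^x+2^x*5^[1+y]≢square : ∀ x y z → 2 ^ x + 2 ^ x * 5 ^ suc y ≢ z * z
2^x+2^x*5^[1+y]≢square x y z eq =
  let q , 5^[1+y]≡1+4q = 5^n≡1+4* (suc y)
      _ , o , _ , 1+2q≡o² , _ = square-decomposition prime[2] {suc x} z
                                  (trans (regroup (2 ^ x) q)
                                         (trans (cong (λ w → 2 ^ x + 2 ^ x * w) (sym 5^[1+y]≡1+4q)) eq))
                                  (2∤1+2* q)
  in 1+5^[1+y]≢2*square y o (trans (cong suc 5^[1+y]≡1+4q) (trans (double q) (cong (2 *_) 1+2q≡o²)))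
  where
  double : ∀ q → 2 + 4 * q ≡ 2 * (1 + 2 * q)
  double = solve-∀
  regroup : ∀ p q → 2 * p * (1 + 2 * q) ≡ p + p * (1 + 4 * q)
  regroup = solve-∀

2^[2t]+5^[2s]≢square : ∀ t s o → 2 ^ (2 * t) + 5 ^ (2 * s) ≢ o * o
2^[2t]+5^[2s]≢square t s o eq =
  let a , 2^[2t]≡1+3a = 2^[2n]≡1+3* t
      b , 5^[2s]≡1+3b = 5^[2n]≡1+3* s
  in square%3≢2 o (begin
       (o * o) % 3                      ≡⟨ cong (_% 3) eq ⟨
       (2 ^ (2 * t) + 5 ^ (2 * s)) % 3  ≡⟨ cong₂ (λ u v → (u + v) % 3) 2^[2t]≡1+3a 5^[2s]≡1+3b ⟩
       ((1 + 3 * a) + (1 + 3 * b)) % 3  ≡⟨ cong (_% 3) (regroup a b) ⟩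
       (2 + 3 * (a + b)) % 3            ≡⟨ [r+dq]%d≡r%d 2 3 (a + b) ⟩
       2                                ∎)
  where
  open ≡-Reasoning
  regroup : ∀ a b → (1 + 3 * a) + (1 + 3 * b) ≡ 2 + 3 * (a + b)
  regroup = solve-∀

2^E+5^[1+2s]≡[1+2r]²⇒E≡2 : ∀ E s r → 2 ^ E + 5 ^ (1 + 2 * s) ≡ (1 + 2 * r) * (1 + 2 * r) → E ≡ 2
2^E+5^[1+2s]≡[1+2r]²⇒E≡2 E s r eq =
  let b , 5^[2s]≡1+8b = 5^[2n]≡1+8* s
      c , [1+2r]²≡1+8c = [1+2s]²≡1+8* r
      [2^E+5]%8≡1 = r+dq≡s+dq′⇒r%d≡s%d 8 {2 ^ E + 5} {1} {5 * b} {c} (begin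
        2 ^ E + 5 + 8 * (5 * b)    ≡⟨ regroup (2 ^ E) b ⟨
        2 ^ E + 5 * (1 + 8 * b)    ≡⟨ cong (λ a → 2 ^ E + 5 * a) 5^[2s]≡1+8b ⟨
        2 ^ E + 5 ^ (1 + 2 * s)    ≡⟨ eq ⟩
        (1 + 2 * r) * (1 + 2 * r)  ≡⟨ [1+2r]²≡1+8c ⟩
        1 + 8 * c                  ∎)
  in 2^c%8≡4⇒c≡2 E (residue (trans (sym (%-distribˡ-+ (2 ^ E) 5 8)) [2^E+5]%8≡1))
  where
  open ≡-Reasoning
  regroup : ∀ x b → x + 5 * (1 + 8 * b) ≡ x + 5 + 8 * (5 * b)
  regroup = solve-∀
  residue : ((2 ^ E) % 8 + 5) % 8 ≡ 1 → (2 ^ E) % 8 ≡ 4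
  residue = ∀-residue 8 (λ r → ((r + 5) % 8 ≟ 1) →-dec (r ≟ 4)) (2 ^ E)

t[4+t]≡5^[1+y] : ∀ t y → t * (4 + t) ≡ 5 ^ suc y → t ≡ 1 × y ≡ 0
t[4+t]≡5^[1+y] t y eq with factors-of-prime-power prime[5] {t} {4 + t} (suc y) eq
... | zero , j , refl , 5≡5^j , 1+j≡1+y with refl ← ^-injective prime[5] {1} {j} 5≡5^j =
  refl , sym (suc-injective 1+j≡1+y)
... | suc i , zero , refl , () , _
... | suc i , suc j , refl , 4+t≡5^[1+j] , _ =
  ⊥-elim (>⇒∤ (n<1+n 4)
           (∣m+n∣m⇒∣n (subst (5 ∣_) (trans (sym 4+t≡5^[1+j]) (+-comm 4 _)) (5∣5^[1+i] j)) (5∣5^[1+i] i)))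

4+5^[1+y]≡square : ∀ y o → 4 + 5 ^ suc y ≡ o * o → y ≡ 0 × o ≡ 3
4+5^[1+y]≡square y zero          ()
4+5^[1+y]≡square y (suc zero)    ()
4+5^[1+y]≡square y (suc (suc t)) eq = proj₂ t≡1×y≡0 , cong (2 +_) (proj₁ t≡1×y≡0)
  where
  expand : ∀ t → suc (suc t) * suc (suc t) ≡ 4 + t * (4 + t)
  expand = solve-∀
  t≡1×y≡0 : t ≡ 1 × y ≡ 0
  t≡1×y≡0 = t[4+t]≡5^[1+y] t y (sym (+-cancelˡ-≡ 4 _ _ (trans eq (expand t))))

-- For odd y + 1 reduction mod 8 forces E = 2; for even y + 1 reduction mod 3 (E even)
-- or mod 5 (E odd) rules out a square.
2^E+5^[1+y]≡square : ∀ E y {o} → 2 ∤ o → 2 ^ E + 5 ^ suc y ≡ o * o → E ≡ 2 × y ≡ 0 × o ≡ 3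
2^E+5^[1+y]≡square E y {o} 2∤o eq with even⊎odd (suc y) | even⊎odd E
... | s , inj₂ refl | _
  with r , refl ← 2∤⇒≡1+2* 2∤o
  with refl ← 2^E+5^[1+2s]≡[1+2r]²⇒E≡2 E s r eq
  = refl , 4+5^[1+y]≡square (2 * s) _ eq
... | s , inj₁ 1+y≡2s | t , inj₁ refl =
  ⊥-elim (2^[2t]+5^[2s]≢square t s o (subst (λ n → 2 ^ (2 * t) + 5 ^ n ≡ o * o) 1+y≡2s eq))
... | _ , inj₁ _ | t , inj₂ refl =
  ⊥-elim (square%5≢2^odd t o (trans (cong (_% 5) (sym eq)) ([r+dq]%d≡r%d (2 ^ (1 + 2 * t)) 5 (5 ^ y))))

listed-z≡2^b*9 : ∀ b → IsListedSolution (suc (b + b + 3)) (b + b) 1 (2 ^ b * 9)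
listed-z≡2^b*9 b = inj₂ (inj₂ (suc b , s≤s z≤n , k≡ b , x≡ , refl , z≡))
  where
  k≡ : ∀ b → suc (b + b + 3) ≡ 2 * suc b + 2
  k≡ = solve-∀
  2[1+b]≡2+[b+b] : ∀ b → 2 * suc b ≡ 2 + (b + b)
  2[1+b]≡2+[b+b] = solve-∀
  x≡ : b + b ≡ 2 * suc b ∸ 2
  x≡ = sym (trans (cong (_∸ 2) (2[1+b]≡2+[b+b] b)) (m+n∸m≡n 2 (b + b)))
  nine : ∀ a → a * 9 ≡ a + 2 * (a * 4)
  nine = solve-∀
  z≡ : 2 ^ b * 9 ≡ 2 ^ b + 2 ^ (suc b + 2)
  z≡ = trans (nine (2 ^ b)) (cong (λ p → 2 ^ b + 2 * p) (sym (^-distribˡ-+-* 2 b 2)))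

listed-z≡2^b*3 : ∀ b → 1 ≤ b → IsListedSolution (b + b) (suc (b + b + 1)) 1 (2 ^ b * 3)
listed-z≡2^b*3 b 1≤b = inj₂ (inj₁ (b , 1≤b , k≡ b , x≡ b , refl , z≡))
  where
  k≡ : ∀ b → b + b ≡ 2 * b
  k≡ = solve-∀
  x≡ : ∀ b → suc (b + b + 1) ≡ 2 * b + 2
  x≡ = solve-∀
  three : ∀ a → a * 3 ≡ a + a * 2
  three = solve-∀
  z≡ : 2 ^ b * 3 ≡ 2 ^ b + 2 ^ (b + 1)
  z≡ = trans (three (2 ^ b)) (cong (2 ^ b +_) (sym (^-distribˡ-+-* 2 b 1)))

1≤n+n⇒1≤n : ∀ {n} → 1 ≤ n + n → 1 ≤ n
1≤n+n⇒1≤n {suc n} _ = s≤s z≤n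

2^x+2^K*5^[1+y]≡square : ∀ {K} x y z → 1 ≤ K → 2 ^ x + 2 ^ K * 5 ^ suc y ≡ z * z →
                         y ≡ 0 × IsListedSolution K x 1 z
2^x+2^K*5^[1+y]≡square {K} x y z 1≤K eq with compare x K
... | less x e
  with b , o , refl , 1+2^[1+e]*5^[1+y]≡o² , refl , 2∤o ← square-decomposition prime[2] {x} z
         (trans (sym (^-factorˡ 2 x e (5 ^ suc y))) eq)
         (subst (λ n → 2 ∤ 1 + n) (sym (*-assoc 2 (2 ^ e) (5 ^ suc y))) (2∤1+2* (2 ^ e * 5 ^ suc y)))
  with refl , y≡0 , refl ← 1+2^[1+e]*5^[1+y]≡square e y 2∤o 1+2^[1+e]*5^[1+y]≡o²
  = y≡0 , listed-z≡2^b*9 b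
... | equal x = ⊥-elim (2^x+2^x*5^[1+y]≢square x y z eq)
... | greater K e
  with b , o , refl , 2^[1+e]+5^[1+y]≡o² , refl , 2∤o ← square-decomposition prime[2] {K} z
         (trans (sym (^-factorʳ 2 K e (5 ^ suc y))) eq)
         (λ 2∣2^[1+e]+5^[1+y] → 2∤5^ (suc y) (∣m+n∣m⇒∣n 2∣2^[1+e]+5^[1+y] (m∣m*n (2 ^ e))))
  with refl , y≡0 , refl ← 2^E+5^[1+y]≡square (suc e) y 2∤o 2^[1+e]+5^[1+y]≡o²
  = y≡0 , listed-z≡2^b*3 b (1≤n+n⇒1≤n 1≤K)

listed⇒solution : ∀ {k x y z} → IsListedSolution k x y z → 2 ^ x + (2 ^ k * 5) ^ y ≡ z ^ 2
listed⇒solution (inj₁ (refl , refl , refl)) = refl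
listed⇒solution (inj₂ (inj₁ (n , _ , refl , refl , refl , refl))) = begin
  2 ^ (2 * n + 2) + (2 ^ (2 * n) * 5) ^ 1
    ≡⟨ cong₂ (λ p q → p + (q * 5) ^ 1) 2^[2n+2]≡a²*4 (2^[2n]≡[2^n]² n) ⟩
  a * a * 4 + (a * a * 5) ^ 1
    ≡⟨ identity a ⟩
  (a + a * 2) ^ 2
    ≡⟨ cong (λ p → (a + p) ^ 2) (^-distribˡ-+-* 2 n 1) ⟨
  (2 ^ n + 2 ^ (n + 1)) ^ 2
    ∎
  where
  open ≡-Reasoning
  a : ℕ
  a = 2 ^ n
  2^[2n+2]≡a²*4 : 2 ^ (2 * n + 2) ≡ a * a * 4
  2^[2n+2]≡a²*4 = trans (^-distribˡ-+-* 2 (2 * n) 2) (cong (_* 4) (2^[2n]≡[2^n]² n))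
  identity : ∀ a → a * a * 4 + a * a * 5 * 1 ≡ (a + a * 2) * ((a + a * 2) * 1)
  identity = solve-∀
listed⇒solution (inj₂ (inj₂ (suc m , _ , refl , refl , refl , refl))) = begin
  2 ^ (2 * suc m ∸ 2) + (2 ^ (2 * suc m + 2) * 5) ^ 1
    ≡⟨ cong₂ (λ p q → p + (q * 5) ^ 1) 2^x≡a² 2^k≡a²*16 ⟩
  a * a + (a * a * 16 * 5) ^ 1
    ≡⟨ identity a ⟩
  (a + 2 * (a * 4)) ^ 2
    ≡⟨ cong (λ p → (a + 2 * p) ^ 2) (^-distribˡ-+-* 2 m 2) ⟨
  (2 ^ m + 2 ^ (suc m + 2)) ^ 2
    ∎
  where
  open ≡-Reasoning
  a : ℕ
  a = 2 ^ m
  2^x≡a² : 2 ^ (2 * suc m ∸ 2) ≡ a * a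
  2^x≡a² = trans (cong (λ k → 2 ^ (k ∸ 1)) (+-suc m (m + 0))) (2^[2n]≡[2^n]² m)
  2[1+m]+2≡2m+4 : ∀ m → 2 * suc m + 2 ≡ 2 * m + 4
  2[1+m]+2≡2m+4 = solve-∀
  2^k≡a²*16 : 2 ^ (2 * suc m + 2) ≡ a * a * 16
  2^k≡a²*16 = trans (cong (2 ^_) (2[1+m]+2≡2m+4 m))
                    (trans (^-distribˡ-+-* 2 (2 * m) 4) (cong (_* 16) (2^[2n]≡[2^n]² m)))
  identity : ∀ a → a * a + a * a * 16 * 5 * 1 ≡ (a + 2 * (a * 4)) * ((a + 2 * (a * 4)) * 1)
  identity = solve-∀

[2^k*5]^y≡2^[k*y]*5^y : ∀ k y → (2 ^ k * 5) ^ y ≡ 2 ^ (k * y) * 5 ^ y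
[2^k*5]^y≡2^[k*y]*5^y k y = trans (^-distribʳ-* (2 ^ k) 5 y) (cong (_* 5 ^ y) (^-*-assoc 2 k y))

solution⇒listed : ∀ k → 1 ≤ k → ∀ x y z →
                  2 ^ x + (2 ^ k * 5) ^ y ≡ z ^ 2 → IsListedSolution k x y z
solution⇒listed k _ x zero z eq
  with refl , refl ← 2^x+1≡square x z (trans eq (cong (z *_) (*-identityʳ z)))
  = inj₁ (refl , refl , refl)
solution⇒listed k 1≤k x (suc y) z eq
  with refl , listed ← 2^x+2^K*5^[1+y]≡square x y z (≤-trans 1≤k (m≤m*n k (suc y)))
         (trans (cong (2 ^ x +_) (sym ([2^k*5]^y≡2^[k*y]*5^y k (suc y))))
                (trans eq (cong (z *_) (*-identityʳ z))))
  = subst (λ K → IsListedSolution K x 1 z) (*-identityʳ k) listed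

theorem3p3 : (k : ℕ) → 1 ≤ k → (x y z : ℕ) →
    ((2 ^ x + (2 ^ k * 5) ^ y ≡ z ^ 2 → IsListedSolution k x y z)
     × (IsListedSolution k x y z → 2 ^ x + (2 ^ k * 5) ^ y ≡ z ^ 2))
theorem3p3 k 1≤k x y z = solution⇒listed k 1≤k x y z , listed⇒solution
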